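{- Let $G=C_{n_1}\oplus C_{n_2}\oplus\cdots\oplus C_{n_t}$ with $n_i\mid n_{i+1}$ for all $i$. Let $k$ be a positive integer with $k<n_t$, and let $\epsilon=1$ if $k\mid n_t$ and $\epsilon=0$ otherwise. Then $$g^k(G)\ \ge\ \frac{|G|}{n_t}\left(\left\lfloor\frac{n_t}{k}\right\rfloor-\epsilon\right)+1.$$
   Context: $C_n$ denotes the cyclic group of order $n$. For a finite abelian group $G$ (written additively) and a positive integer $k$, the $k$-Harborth constant $g^k(G)$ is the smallest positive integer $t$ such that every subset $S\subseteq G$ with $|S|\ge t$ contains a subset $T$ with $|T|=k$ and $\sum_{x\in T}x=0$. -}

module Defs where

open import Data.Nat using (ℕ; zero; suc; _≤_; _<_; _*_; _∸_; _+_; NonZero)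
open import Data.Nat.DivMod using (_/_)
open import Data.Nat.Divisibility using (_∣_; _∣?_)
open import Data.Fin using (Fin)
open import Data.Vec using (Vec; lookup; last)
open import Data.List using (List; length; map)
open import Data.Nat.ListAction using (sum)
open import Data.List.Relation.Unary.All using (All)
open import Data.List.Relation.Unary.Unique.Propositional using (Unique)
open import Data.List.Relation.Binary.Sublist.Propositional using (_⊆_)
open import Data.Product using (Σ; _×_)
open import Data.Bool using (if_then_else_)
open import Relation.Nullary.Decidable using (does)
open import Relation.Binary.PropositionalEquality using (_≡_)

-- The group G = C_{n_1} ⊕ ... ⊕ C_{n_t} is described by ns = (n_1,...,n_t).
-- An element is a vector x with 0 ≤ x_i < n_i (x_i a residue mod n_i).
InG : ∀ {t} → Vec ℕ t → Vec ℕ t → Set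
InG {t} ns x = (i : Fin t) → lookup x i < lookup ns i

order : ∀ {t} → Vec ℕ t → ℕ
order ns = Data.Vec.foldr _ _*_ 1 ns

IsSubsetOfG : ∀ {t} → Vec ℕ t → List (Vec ℕ t) → Set
IsSubsetOfG ns S = All (InG ns) S × Unique S

ZeroSum : ∀ {t} → Vec ℕ t → List (Vec ℕ t) → Set
ZeroSum {t} ns T = (i : Fin t) → lookup ns i ∣ sum (map (λ x → lookup x i) T)

HasZeroSumSubset : ∀ {t} → Vec ℕ t → ℕ → List (Vec ℕ t) → Set
HasZeroSumSubset {t} ns k S =
  Σ (List (Vec ℕ t)) (λ T → (T ⊆ S) × (length T ≡ k) × ZeroSum ns T)

Works : ∀ {t} → Vec ℕ t → ℕ → ℕ → Set
Works {t} ns k m =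
  (S : List (Vec ℕ t)) → IsSubsetOfG ns S → m ≤ length S → HasZeroSumSubset ns k S

IsHarborth : ∀ {t} → Vec ℕ t → ℕ → ℕ → Set
IsHarborth ns k g = (1 ≤ g) × Works ns k g × ((m : ℕ) → 1 ≤ m → Works ns k m → g ≤ m)

eps : ℕ → ℕ → ℕ
eps k n = if does (k ∣? n) then 1 else 0

harborthBound : ∀ {t} (ns : Vec ℕ (suc t)) (k : ℕ) →
  .{{_ : NonZero k}} → .{{_ : NonZero (last ns)}} → ℕ
harborthBound ns k = (order ns / last ns) * ((last ns / k) ∸ eps k (last ns)) + 1

{-# OPTIONS --safe #-}
module Submission where

-- Put n = n_t and m = ⌊n/k⌋ − ε, so that k m < n.  Let S be the set of elements of G
-- whose last coordinate lies in {1, …, m}; it has |G|/n · m elements.  The last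
-- coordinates of any k elements of S sum to a number between k and k m < n, which is
-- not divisible by n.  So S has no zero-sum subset of size k, and g^k(G) > |S|.

open import Defs
open import Data.Nat using (ℕ; suc; _+_; _*_; _∸_; _≤_; _<_; z≤n; s≤s; _<?_; NonZero; >-nonZero; >-nonZero⁻¹)
open import Data.Nat.Properties
open import Data.Nat.DivMod using (_/_; m*n/n≡m; m*[n/m]≡n; m/n*n≤m)
open import Data.Nat.Divisibility using (_∣_; _∤_; _∣?_; divides; ∣⇒≤)
open import Data.Nat.ListAction using (sum)
open import Data.Fin using (Fin; inject₁; fromℕ) renaming (zero to fzero; suc to fsuc)
open import Data.Vec using (Vec; []; _∷_; lookup; last; init)
import Data.Vec as Vec
import Data.Vec.Relation.Unary.All as VecAll
open import Data.List using (List; []; _∷_; [_]; _++_; map; length; upTo; applyUpTo; cartesianProductWith)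
open import Data.List.Properties using (length-++; length-map; length-upTo; length-applyUpTo)
open import Data.List.Membership.Propositional using (_∈_)
open import Data.List.Membership.Propositional.Properties
  using (∈-cartesianProductWith⁻; ∈-upTo⁻; ∈-applyUpTo⁻)
open import Data.List.Relation.Unary.All as All using (All; []; _∷_)
import Data.List.Relation.Unary.All.Properties as All
open import Data.List.Relation.Unary.AllPairs using ([]; _∷_)
open import Data.List.Relation.Unary.Unique.Propositional using (Unique)
import Data.List.Relation.Unary.Unique.Propositional.Properties as Unique
open import Data.List.Relation.Binary.Sublist.Propositional.Properties using (All-resp-⊆)
open import Data.Vec.Properties using (∷-injective)
open import Data.Product using (_×_; _,_; proj₁; proj₂)
open import Relation.Nullary using (¬_; yes; no; contradiction)
open import Relation.Binary.PropositionalEquality using (_≡_; _≢_; refl; sym; trans; cong; cong₂; subst; module ≡-Reasoning)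

*[/∸eps]< : ∀ {n} k .{{_ : NonZero k}} → k ≤ n → k * (n / k ∸ eps k n) < n
*[/∸eps]< {n} k k≤n with k ∣? n
... | yes k∣n = begin-strict
  k * (n / k ∸ 1)      ≡⟨ *-distribˡ-∸ k (n / k) 1 ⟩
  k * (n / k) ∸ k * 1  ≡⟨ cong₂ _∸_ (m*[n/m]≡n k∣n) (*-identityʳ k) ⟩
  n ∸ k                <⟨ ∸-monoʳ-< (>-nonZero⁻¹ k) k≤n ⟩
  n                    ∎
  where open ≤-Reasoning
... | no k∤n = ≤∧≢⇒< k*[n/k]≤n k*[n/k]≢n
  where
  k*[n/k]≤n : k * (n / k) ≤ n
  k*[n/k]≤n = ≤-trans (≤-reflexive (*-comm k (n / k))) (m/n*n≤m n k)
  k*[n/k]≢n : k * (n / k) ≢ n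
  k*[n/k]≢n k*[n/k]≡n = k∤n (divides (n / k) (trans (sym k*[n/k]≡n) (*-comm k (n / k))))

length≤sum : {xs : List ℕ} → All (1 ≤_) xs → length xs ≤ sum xs
length≤sum []         = z≤n
length≤sum (1≤x ∷ ps) = +-mono-≤ 1≤x (length≤sum ps)

sum≤length* : ∀ {m} {xs : List ℕ} → All (_≤ m) xs → sum xs ≤ length xs * m
sum≤length* []         = z≤n
sum≤length* (x≤m ∷ ps) = +-mono-≤ x≤m (sum≤length* ps)

length*m<n⇒∤sum : ∀ {m n} {xs : List ℕ} → 0 < length xs →
  All (λ x → 1 ≤ x × x ≤ m) xs → length xs * m < n → n ∤ sum xs
length*m<n⇒∤sum {m} {n} {xs} 0<len bounded len*m<n n∣sum =
  <-irrefl refl (≤-<-trans n≤sum (≤-<-trans (sum≤length* (All.map proj₂ bounded)) len*m<n))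
  where
  len≤sum : length xs ≤ sum xs
  len≤sum = length≤sum (All.map proj₁ bounded)
  n≤sum : n ≤ sum xs
  n≤sum = ∣⇒≤ {{>-nonZero (≤-trans 0<len len≤sum)}} n∣sum

length-cartesianProductWith : ∀ {A B C : Set} (f : A → B → C) xs ys →
  length (cartesianProductWith f xs ys) ≡ length xs * length ys
length-cartesianProductWith f []       ys = refl
length-cartesianProductWith f (x ∷ xs) ys = begin
  length (map (f x) ys ++ cartesianProductWith f xs ys)
    ≡⟨ length-++ (map (f x) ys) ⟩
  length (map (f x) ys) + length (cartesianProductWith f xs ys)
    ≡⟨ cong₂ _+_ (length-map (f x) ys) (length-cartesianProductWith f xs ys) ⟩
  length ys + length xs * length ys
    ∎
  where open ≡-Reasoning

box : ∀ {A : Set} {t} → Vec (List A) t → List (Vec A t)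
box []       = [ [] ]
box (L ∷ Ls) = cartesianProductWith _∷_ L (box Ls)

length-box : ∀ {A : Set} {t} (Ls : Vec (List A) t) → length (box Ls) ≡ order (Vec.map length Ls)
length-box []       = refl
length-box (L ∷ Ls) =
  trans (length-cartesianProductWith _∷_ L (box Ls)) (cong (length L *_) (length-box Ls))

∈-box⁻ : ∀ {A : Set} {t} (Ls : Vec (List A) t) {v} → v ∈ box Ls → (i : Fin t) → lookup v i ∈ lookup Ls i
∈-box⁻ (L ∷ Ls) v∈ i with ∈-cartesianProductWith⁻ _∷_ L (box Ls) v∈
... | a , w , a∈L , w∈ , refl with i
...   | fzero  = a∈L
...   | fsuc j = ∈-box⁻ Ls w∈ j

box-unique : ∀ {A : Set} {t} {Ls : Vec (List A) t} → VecAll.All Unique Ls → Unique (box Ls)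
box-unique VecAll.[]       = [] ∷ []
box-unique (u VecAll.∷ us) = Unique.cartesianProductWith⁺ _∷_ ∷-injective u (box-unique us)

last≡lookup-fromℕ : ∀ {A : Set} {t} (xs : Vec A (suc t)) → last xs ≡ lookup xs (fromℕ t)
last≡lookup-fromℕ (_ ∷ [])     = refl
last≡lookup-fromℕ (_ ∷ y ∷ xs) = last≡lookup-fromℕ (y ∷ xs)

order≡order-init*last : ∀ {t} (ns : Vec ℕ (suc t)) → order ns ≡ order (init ns) * last ns
order≡order-init*last (n ∷ [])      = *-comm n 1
order≡order-init*last (n ∷ n′ ∷ ns) =
  trans (cong (n *_) (order≡order-init*last (n′ ∷ ns))) (sym (*-assoc n _ _))

coordinateRanges : ∀ {t} → ℕ → Vec ℕ (suc t) → Vec (List ℕ) (suc t)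
coordinateRanges m (_ ∷ [])      = applyUpTo suc m ∷ []
coordinateRanges m (n ∷ n′ ∷ ns) = upTo n ∷ coordinateRanges m (n′ ∷ ns)

slab : ∀ {t} → ℕ → Vec ℕ (suc t) → List (Vec ℕ (suc t))
slab m ns = box (coordinateRanges m ns)

order-lengths-coordinateRanges : ∀ {t} m (ns : Vec ℕ (suc t)) →
  order (Vec.map length (coordinateRanges m ns)) ≡ order (init ns) * m
order-lengths-coordinateRanges m (_ ∷ []) =
  trans (*-identityʳ _) (trans (length-applyUpTo suc m) (sym (*-identityˡ m)))
order-lengths-coordinateRanges m (n ∷ n′ ∷ ns) =
  trans (cong₂ _*_ (length-upTo n) (order-lengths-coordinateRanges m (n′ ∷ ns))) (sym (*-assoc n _ m))

coordinateRanges-unique : ∀ {t} m (ns : Vec ℕ (suc t)) → VecAll.All Unique (coordinateRanges m ns)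
coordinateRanges-unique m (_ ∷ []) =
  Unique.applyUpTo⁺₁ suc m (λ i<j _ → <⇒≢ (s≤s i<j)) VecAll.∷ VecAll.[]
coordinateRanges-unique m (n ∷ n′ ∷ ns) = Unique.upTo⁺ n VecAll.∷ coordinateRanges-unique m (n′ ∷ ns)

∈-coordinateRanges⇒< : ∀ {t m a} (ns : Vec ℕ (suc t)) → m < last ns →
  (i : Fin (suc t)) → a ∈ lookup (coordinateRanges m ns) i → a < lookup ns i
∈-coordinateRanges⇒< (_ ∷ []) m<n fzero a∈ with ∈-applyUpTo⁻ suc a∈
... | _ , j<m , refl = ≤-<-trans j<m m<n
∈-coordinateRanges⇒< (_ ∷ _ ∷ _)  m<n fzero    a∈ = ∈-upTo⁻ a∈
∈-coordinateRanges⇒< (_ ∷ n′ ∷ ns) m<n (fsuc i) a∈ = ∈-coordinateRanges⇒< (n′ ∷ ns) m<n i a∈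

lookup-coordinateRanges-fromℕ : ∀ {t} m (ns : Vec ℕ (suc t)) →
  lookup (coordinateRanges m ns) (fromℕ t) ≡ applyUpTo suc m
lookup-coordinateRanges-fromℕ m (_ ∷ [])      = refl
lookup-coordinateRanges-fromℕ m (_ ∷ n′ ∷ ns) = lookup-coordinateRanges-fromℕ m (n′ ∷ ns)

slab⊆G : ∀ {t m} (ns : Vec ℕ (suc t)) → m < last ns → IsSubsetOfG ns (slab m ns)
slab⊆G {m = m} ns m<n =
  All.tabulate (λ x∈ i → ∈-coordinateRanges⇒< ns m<n i (∈-box⁻ (coordinateRanges m ns) x∈ i)) ,
  box-unique (coordinateRanges-unique m ns)

length-slab : ∀ {t} m (ns : Vec ℕ (suc t)) .{{_ : NonZero (last ns)}} →
  length (slab m ns) ≡ order ns / last ns * m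
length-slab m ns = begin
  length (slab m ns)                             ≡⟨ length-box (coordinateRanges m ns) ⟩
  order (Vec.map length (coordinateRanges m ns)) ≡⟨ order-lengths-coordinateRanges m ns ⟩
  order (init ns) * m                            ≡⟨ cong (_* m) order-init≡order/last ⟩
  order ns / last ns * m                         ∎
  where
  open ≡-Reasoning
  order-init≡order/last : order (init ns) ≡ order ns / last ns
  order-init≡order/last =
    sym (trans (cong (_/ last ns) (order≡order-init*last ns)) (m*n/n≡m (order (init ns)) (last ns)))

slab-lastCoordinate : ∀ {t m} (ns : Vec ℕ (suc t)) {x} → x ∈ slab m ns →
  1 ≤ lookup x (fromℕ t) × lookup x (fromℕ t) ≤ m
slab-lastCoordinate {t} {m} ns {x} x∈ =
  let j , j<m , xₜ≡1+j = ∈-applyUpTo⁻ suc xₜ∈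
  in  subst (λ a → 1 ≤ a × a ≤ m) (sym xₜ≡1+j) (s≤s z≤n , j<m)
  where
  xₜ∈ : lookup x (fromℕ t) ∈ applyUpTo suc m
  xₜ∈ = subst (lookup x (fromℕ t) ∈_) (lookup-coordinateRanges-fromℕ m ns)
              (∈-box⁻ (coordinateRanges m ns) x∈ (fromℕ t))

slab-zeroSumFree : ∀ {t m} (ns : Vec ℕ (suc t)) k .{{_ : NonZero k}} →
  k * m < last ns → ¬ HasZeroSumSubset ns k (slab m ns)
slab-zeroSumFree {t} {m} ns k k*m<n (T , T⊆S , |T|≡k , zeroSum) =
  length*m<n⇒∤sum 0<|xs| bounded (subst (λ l → l * m < last ns) (sym |xs|≡k) k*m<n) n∣sum
  where
  xs : List ℕ
  xs = map (λ x → lookup x (fromℕ t)) T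
  |xs|≡k : length xs ≡ k
  |xs|≡k = trans (length-map _ T) |T|≡k
  0<|xs| : 0 < length xs
  0<|xs| = subst (0 <_) (sym |xs|≡k) (>-nonZero⁻¹ k)
  bounded : All (λ a → 1 ≤ a × a ≤ m) xs
  bounded = All.map⁺ (All-resp-⊆ T⊆S (All.tabulate (slab-lastCoordinate ns)))
  n∣sum : last ns ∣ sum xs
  n∣sum = subst (_∣ sum xs) (sym (last≡lookup-fromℕ ns)) (zeroSum (fromℕ t))

Works⇒length< : ∀ {t k g} (ns : Vec ℕ t) S → Works ns k g →
  IsSubsetOfG ns S → ¬ HasZeroSumSubset ns k S → length S < g
Works⇒length< {g = g} ns S works S⊆G free with length S <? g
... | yes |S|<g = |S|<g
... | no  |S|≮g = contradiction (works S S⊆G (≮⇒≥ |S|≮g)) free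

proposition3p4 : (t : ℕ) (ns : Vec ℕ (suc t)) →
    ((i : Fin t) → lookup ns (inject₁ i) ∣ lookup ns (fsuc i)) →
    (k : ℕ) → .{{_ : NonZero k}} → .{{_ : NonZero (last ns)}} →
    k < last ns →
    (g : ℕ) → IsHarborth ns k g →
    harborthBound ns k ≤ g
proposition3p4 t ns _ k k<n g (_ , works , _) = begin
  order ns / last ns * m + 1  ≡⟨ cong (_+ 1) (sym (length-slab m ns)) ⟩
  length (slab m ns) + 1      ≡⟨ +-comm _ 1 ⟩
  suc (length (slab m ns))    ≤⟨ Works⇒length< ns (slab m ns) works (slab⊆G ns m<n) (slab-zeroSumFree ns k k*m<n) ⟩
  g                           ∎
  where
  open ≤-Reasoning
  m : ℕ
  m = last ns / k ∸ eps k (last ns)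
  k*m<n : k * m < last ns
  k*m<n = *[/∸eps]< k (<⇒≤ k<n)
  m<n : m < last ns
  m<n = ≤-<-trans (m≤n*m m k) k*m<n
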